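{- For any integer $n\geq 1$, $$\Phi(C_{2n})\geq \binom{n}{2} + \left\lfloor\frac{n}{2}\right\rfloor +1.$$
   Context: $C_m$ denotes the cycle with vertices $0,1,\dots,m-1$ and edges $\{i,i+1 \bmod m\}$. For a connected graph $G$ with vertex set $V(G)$, a path system of $G$ is a set consisting of one chosen path in $G$ connecting $a$ and $b$ for each unordered pair $\{a,b\}$ of distinct vertices. A global packing of $(G,\mathcal{P})$ is a map $\omega:\mathcal{P}\to\{1,\dots,k\}$ such that $\omega(P)\neq\omega(P')$ whenever distinct paths $P,P'\in\mathcal{P}$ share at least one edge; $\Phi(G,\mathcal{P})$ is the minimum such $k$, and $\Phi(G)$ is the minimum of $\Phi(G,\mathcal{P})$ over all path systems $\mathcal{P}$ of $G$. -}

module Defs where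

open import Data.Nat using (ℕ; suc; _+_; _%_)
open import Data.Fin using (Fin; toℕ; _<_)
open import Data.List using (List; []; _∷_)
open import Data.List.Relation.Unary.Unique.Propositional using (Unique)
open import Data.Product using (Σ; ∃; ∃-syntax; _×_; _,_)
open import Data.Sum using (_⊎_)
open import Relation.Binary.PropositionalEquality using (_≡_)
open import Relation.Nullary using (¬_)

CAdj : (m : ℕ) → Fin m → Fin m → Set
CAdj (suc k) i j = (toℕ j ≡ (toℕ i + 1) % suc k) ⊎ (toℕ i ≡ (toℕ j + 1) % suc k)
CAdj 0 () j

data Walk (m : ℕ) : Fin m → Fin m → Set where
  nil  : (a : Fin m) → Walk m a a
  cons : {a b c : Fin m} → CAdj m a b → Walk m b c → Walk m a c

verts : {m : ℕ} {a b : Fin m} → Walk m a b → List (Fin m)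
verts (nil a) = a ∷ []
verts (cons {a = a} _ w) = a ∷ verts w

record Path (m : ℕ) (a b : Fin m) : Set where
  constructor mkPath
  field
    walk   : Walk m a b
    simple : Unique (verts walk)

data EdgeIn {m : ℕ} : {a b : Fin m} → Walk m a b → Fin m → Fin m → Set where
  here  : {a b c : Fin m} (e : CAdj m a b) (w : Walk m b c) → EdgeIn (cons e w) a b
  there : {a b c u v : Fin m} (e : CAdj m a b) {w : Walk m b c} →
          EdgeIn w u v → EdgeIn (cons e w) u v

HasEdge : {m : ℕ} {a b : Fin m} → Path m a b → Fin m → Fin m → Set
HasEdge P u v = EdgeIn (Path.walk P) u v ⊎ EdgeIn (Path.walk P) v u

ShareEdge : {m : ℕ} {a b c d : Fin m} → Path m a b → Path m c d → Set
ShareEdge P Q = ∃[ u ] ∃[ v ] (HasEdge P u v × HasEdge Q u v)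

-- A path system of C_m: one chosen path for each unordered pair {a , b}
-- of distinct vertices, represented by the ordered pair with a < b.
PathSystem : ℕ → Set
PathSystem m = (a b : Fin m) → a < b → Path m a b

-- A global packing of (C_m , 𝒫) with k colours (colours 1..k ↔ Fin k).
IsGlobalPacking : {m : ℕ} (𝒫 : PathSystem m) (k : ℕ) →
                  ((a b : Fin m) → a < b → Fin k) → Set
IsGlobalPacking {m} 𝒫 k ω =
  (a b c d : Fin m) (ab : a < b) (cd : c < d) →
  ¬ (a ≡ c × b ≡ d) →
  ShareEdge (𝒫 a b ab) (𝒫 c d cd) →
  ¬ (ω a b ab ≡ ω c d cd)

-- Route each pair {a , b} along its chosen path and let Load j count the routes through the
-- edge {j , j + 1} of C_{2n}.  Routes through a common edge have distinct colours, so Load j ≤ k.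
-- The half-cycles {0 , … , n − 1} and {1 , … , n} each separate n² pairs, whose routes must cross
-- one of the two boundary edges, so n² ≤ Load (n − 1) + Load (2n − 1) and n² ≤ Load n + Load 0.
-- If 2k ≤ n² this forces Load (2n − 1) = Load 0 = k.  But these are the two edges at vertex 0,
-- and a path uses exactly one of them iff 0 is an endpoint, so Load (2n − 1) + Load 0 is 2n − 1
-- plus an even number, hence odd.  Thus n² < 2k, and 2 (n C 2 + ⌊n/2⌋) ≤ n² gives the bound.
module Submission where

open import Algebra.Bundles using (CommutativeRing)
open import Data.Bool using (Bool; true; false; not; _∧_; _∨_; _xor_; T)
open import Data.Bool.Properties
  using (xor-∧-commutativeRing; xor-assoc; xor-comm; xor-same; xor-identityʳ; ∧-inverseʳ; ∧-zeroʳ; T-∧; T-≡)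
  renaming (_≟_ to _≟ᵇ_)
open import Data.Empty using (⊥-elim)
open import Data.Fin using (Fin; zero; suc; toℕ) renaming (_<_ to _<ᶠ_)
open import Data.Fin.Properties using (toℕ-injective; toℕ<n; <-cmp; 0≢1+n)
  renaming (_≟_ to _≟ᶠ_; _<?_ to _<ᶠ?_; suc-injective to suc-injectiveᶠ)
open import Data.List.Membership.Propositional using (_∈_)
open import Data.List.Relation.Unary.All using (All)
open import Data.List.Relation.Unary.All.Properties using (All¬⇒¬Any)
open import Data.List.Relation.Unary.Any using (here; there)
open import Data.List.Relation.Unary.AllPairs using (_∷_)
open import Data.List.Relation.Unary.Unique.Propositional using (Unique)
open import Data.Nat
  using (ℕ; zero; suc; _+_; _*_; _/_; _%_; _≤_; _<_; _<ᵇ_; _≡ᵇ_; z≤n; s≤s; s≤s⁻¹; pred)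
open import Data.Nat.Combinatorics using (_C_; nC1≡n; nCk+nC[k+1]≡[n+1]C[k+1])
open import Data.Nat.DivMod using (m<n⇒m%n≡m; n%n≡0; m/n*n≤m)
open import Data.Nat.Properties
  using (_≟_; _<?_; +-*-semiring; module ≤-Reasoning; ≤-refl; ≤-trans; ≤-antisym; ≮⇒≥; ≤⇒≯; <⇒≢;
         n≤0⇒n≡0; n≢0⇒n>0; m≤m+n; m≤n+m; m≤n⇒m≤1+n; ≡ᵇ⇒≡; ≡⇒≡ᵇ; +-comm; +-identityʳ; +-mono-≤;
         +-monoˡ-≤; +-monoʳ-≤; +-cancelˡ-≡; +-cancelˡ-≤; *-comm; *-identityˡ; *-distribˡ-+;
         *-cancelˡ-<; even≢odd)
open import Data.Nat.Tactic.RingSolver using (solve-∀)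
open import Data.Product using (_×_; _,_; proj₁; proj₂; ∃-syntax; ∃₂)
import Data.Product as Product
open import Data.Sum using (_⊎_; inj₁; inj₂; [_,_]′)
import Data.Sum as Sum
open import Defs
open import Function using (_∘_; Equivalence)
open import Relation.Binary using (tri<; tri≈; tri>)
open import Relation.Binary.PropositionalEquality
open import Relation.Nullary using (¬_; Dec; does; yes; no; contradiction)
open import Relation.Nullary.Decidable using (dec-true; dec-false; decidable-stable; _×-dec_)

open import Algebra.Properties.Semiring.Sum +-*-semiring
  using (sum; sum-syntax; sum-cong-≗; sum-replicate-zero; ∑-comm; ∑-distrib-+;
         *-distribˡ-sum; *-distribʳ-sum)
open import Algebra.Properties.CommutativeSemigroup
  (CommutativeRing.+-commutativeSemigroup xor-∧-commutativeRing)
  using () renaming (interchange to xor-interchange)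

⟦_⟧ : Bool → ℕ
⟦ true ⟧ = 1
⟦ false ⟧ = 0

⟦⟧≤1 : ∀ x → ⟦ x ⟧ ≤ 1
⟦⟧≤1 true = ≤-refl
⟦⟧≤1 false = z≤n

⟦⟧-pos : ∀ {x} → 0 < ⟦ x ⟧ → T x
⟦⟧-pos {true} _ = _

⟦∧⟧ : ∀ x y → ⟦ x ∧ y ⟧ ≡ ⟦ x ⟧ * ⟦ y ⟧
⟦∧⟧ true y = sym (+-identityʳ ⟦ y ⟧)
⟦∧⟧ false y = refl

⟦⟧+⟦not⟧ : ∀ x → ⟦ x ⟧ + ⟦ not x ⟧ ≡ 1
⟦⟧+⟦not⟧ true = refl
⟦⟧+⟦not⟧ false = refl

⟦⟧+⟦⟧ : ∀ x y → ⟦ x ⟧ + ⟦ y ⟧ ≡ ⟦ x xor y ⟧ + 2 * ⟦ x ∧ y ⟧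
⟦⟧+⟦⟧ true true = refl
⟦⟧+⟦⟧ true false = refl
⟦⟧+⟦⟧ false true = refl
⟦⟧+⟦⟧ false false = refl

⟦⟧+⟦⟧-pos : ∀ {x y} → T x ⊎ T y → 1 ≤ ⟦ x ⟧ + ⟦ y ⟧
⟦⟧+⟦⟧-pos {true} _ = s≤s z≤n
⟦⟧+⟦⟧-pos {false} {true} _ = s≤s z≤n
⟦⟧+⟦⟧-pos {false} {false} (inj₁ ())
⟦⟧+⟦⟧-pos {false} {false} (inj₂ ())

⟦xor⟧-≤ : ∀ x y {n} → (x ≢ y → 1 ≤ n) → ⟦ x xor y ⟧ ≤ n
⟦xor⟧-≤ true true _ = z≤n
⟦xor⟧-≤ true false x≢y⇒ = x≢y⇒ λ ()
⟦xor⟧-≤ false true x≢y⇒ = x≢y⇒ λ ()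
⟦xor⟧-≤ false false _ = z≤n

⟦∧xor⟧ : ∀ c x y → ⟦ c ∧ (x xor y) ⟧ ≡ ⟦ c ∧ (x ∧ not y) ⟧ + ⟦ c ∧ (y ∧ not x) ⟧
⟦∧xor⟧ false x y = refl
⟦∧xor⟧ true true true = refl
⟦∧xor⟧ true true false = refl
⟦∧xor⟧ true false true = refl
⟦∧xor⟧ true false false = refl

T-does : ∀ {A : Set} (d : Dec A) → T (does d) → A
T-does (yes a) _ = a

≡ᵇ-true : ∀ {m n} → m ≡ n → (m ≡ᵇ n) ≡ true
≡ᵇ-true {m} {n} = dec-true (m ≟ n)

≡ᵇ-false : ∀ {m n} → m ≢ n → (m ≡ᵇ n) ≡ false
≡ᵇ-false {m} {n} = dec-false (m ≟ n)

<ᵇ-false : ∀ {m n} → n ≤ m → (m <ᵇ n) ≡ false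
<ᵇ-false {m} {n} = dec-false (m <? n) ∘ ≤⇒≯

T-∨-introˡ : ∀ {x} y → T x → T (x ∨ y)
T-∨-introˡ {true} _ _ = _

T-∨-introʳ : ∀ x {y} → T y → T (x ∨ y)
T-∨-introʳ true _ = _
T-∨-introʳ false t = t

xor-telescope : ∀ x y z → (x xor y) xor (y xor z) ≡ x xor z
xor-telescope x y z = begin
  (x xor y) xor (y xor z) ≡⟨ xor-assoc x y (y xor z) ⟩
  x xor (y xor (y xor z)) ≡⟨ cong (x xor_) (sym (xor-assoc y y z)) ⟩
  x xor ((y xor y) xor z) ≡⟨ cong (λ t → x xor (t xor z)) (xor-same y) ⟩
  x xor z                 ∎
  where open ≡-Reasoning

∑-mono-≤ : ∀ {n} {f g : Fin n → ℕ} → (∀ i → f i ≤ g i) → sum f ≤ sum g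
∑-mono-≤ {zero} _ = z≤n
∑-mono-≤ {suc n} f≤g = +-mono-≤ (f≤g zero) (∑-mono-≤ (f≤g ∘ suc))

∑-zero : ∀ {n} {f : Fin n → ℕ} → (∀ i → f i ≡ 0) → sum f ≡ 0
∑-zero {n} f≡0 = trans (sum-cong-≗ f≡0) (sum-replicate-zero n)

∑-one : ∀ n → ∑[ i < n ] 1 ≡ n
∑-one zero = refl
∑-one (suc n) = cong suc (∑-one n)

∑-pos : ∀ {n} (f : Fin n → ℕ) → 0 < sum f → ∃[ i ] 0 < f i
∑-pos {zero} f ()
∑-pos {suc n} f pos with f zero ≟ 0
... | no f₀≢0 = zero , n≢0⇒n>0 f₀≢0
... | yes f₀≡0 with ∑-pos (f ∘ suc) (subst (λ v → 0 < v + sum (f ∘ suc)) f₀≡0 pos)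
...   | i , 0<fᵢ = suc i , 0<fᵢ

∑-≤1 : ∀ {n} {f : Fin n → ℕ} → (∀ i → f i ≤ 1) →
       (∀ {i j} → 0 < f i → 0 < f j → i ≡ j) → sum f ≤ 1
∑-≤1 {zero} _ _ = z≤n
∑-≤1 {suc n} {f} f≤1 unique with f zero ≟ 0
... | yes f₀≡0 = subst (λ v → v + sum (f ∘ suc) ≤ 1) (sym f₀≡0)
                   (∑-≤1 (f≤1 ∘ suc) (λ p q → suc-injectiveᶠ (unique p q)))
... | no f₀≢0 = begin
  f zero + sum (f ∘ suc) ≡⟨ cong (f zero +_) (∑-zero rest≡0) ⟩
  f zero + 0             ≡⟨ +-identityʳ (f zero) ⟩
  f zero                 ≤⟨ f≤1 zero ⟩
  1                      ∎
  where
  open ≤-Reasoning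
  rest≡0 : ∀ i → f (suc i) ≡ 0
  rest≡0 i = n≤0⇒n≡0 (≮⇒≥ (λ pos → 0≢1+n (unique (n≢0⇒n>0 f₀≢0) pos)))

∑-point : ∀ {k} (c : Fin k) → ∑[ i < k ] ⟦ does (c ≟ᶠ i) ⟧ ≡ 1
∑-point {suc k} zero = cong suc (sum-replicate-zero k)
∑-point (suc c) = ∑-point c

∑-below : ∀ {m h} → h ≤ m → ∑[ i < m ] ⟦ toℕ i <ᵇ h ⟧ ≡ h
∑-below {m} {zero} _ = sum-replicate-zero m
∑-below {suc m} {suc h} (s≤s h≤m) = cong suc (∑-below h≤m)

∑-not : ∀ {m} (S : Fin m → Bool) → ∑[ i < m ] ⟦ S i ⟧ + ∑[ i < m ] ⟦ not (S i) ⟧ ≡ m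
∑-not {m} S = begin
  ∑[ i < m ] ⟦ S i ⟧ + ∑[ i < m ] ⟦ not (S i) ⟧ ≡⟨ ∑-distrib-+ (⟦_⟧ ∘ S) (⟦_⟧ ∘ not ∘ S) ⟨
  ∑[ i < m ] (⟦ S i ⟧ + ⟦ not (S i) ⟧)           ≡⟨ sum-cong-≗ (⟦⟧+⟦not⟧ ∘ S) ⟩
  ∑[ i < m ] 1                                   ≡⟨ ∑-one m ⟩
  m                                              ∎
  where open ≡-Reasoning

∑∑ : ∀ {m} → (Fin m → Fin m → ℕ) → ℕ
∑∑ {m} f = ∑[ a < m ] ∑[ b < m ] f a b

∑∑-cong : ∀ {m} {f g : Fin m → Fin m → ℕ} → (∀ a b → f a b ≡ g a b) → ∑∑ f ≡ ∑∑ g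
∑∑-cong f≡g = sum-cong-≗ (λ a → sum-cong-≗ (f≡g a))

∑∑-mono-≤ : ∀ {m} {f g : Fin m → Fin m → ℕ} → (∀ a b → f a b ≤ g a b) → ∑∑ f ≤ ∑∑ g
∑∑-mono-≤ f≤g = ∑-mono-≤ (λ a → ∑-mono-≤ (f≤g a))

∑∑-distrib-+ : ∀ {m} (f g : Fin m → Fin m → ℕ) → ∑∑ (λ a b → f a b + g a b) ≡ ∑∑ f + ∑∑ g
∑∑-distrib-+ f g =
  trans (sum-cong-≗ (λ a → ∑-distrib-+ (f a) (g a))) (∑-distrib-+ (sum ∘ f) (sum ∘ g))

*-distribˡ-∑∑ : ∀ {m} c (f : Fin m → Fin m → ℕ) → c * ∑∑ f ≡ ∑∑ (λ a b → c * f a b)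
*-distribˡ-∑∑ c f = trans (*-distribˡ-sum c (sum ∘ f)) (sum-cong-≗ (λ a → *-distribˡ-sum c (f a)))

∑∑-≤1 : ∀ {m} (g : Fin m → Fin m → Bool) →
        (∀ {a b a′ b′} → T (g a b) → T (g a′ b′) → a ≡ a′ × b ≡ b′) → ∑∑ (λ a b → ⟦ g a b ⟧) ≤ 1
∑∑-≤1 {m} g unique = ∑-≤1 row≤1 rowUnique
  where
  row≤1 : ∀ a → ∑[ b < m ] ⟦ g a b ⟧ ≤ 1
  row≤1 a = ∑-≤1 (⟦⟧≤1 ∘ g a) (λ p q → proj₂ (unique (⟦⟧-pos p) (⟦⟧-pos q)))

  rowUnique : ∀ {a a′} → 0 < ∑[ b < m ] ⟦ g a b ⟧ → 0 < ∑[ b < m ] ⟦ g a′ b ⟧ → a ≡ a′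
  rowUnique {a} {a′} p q with ∑-pos (⟦_⟧ ∘ g a) p | ∑-pos (⟦_⟧ ∘ g a′) q
  ... | _ , p′ | _ , q′ = proj₁ (unique (⟦⟧-pos p′) (⟦⟧-pos q′))

∑∑-≤-colours : ∀ {m k} (f : Fin m → Fin m → Bool) (colour : Fin m → Fin m → Fin k) →
               (∀ {a b a′ b′} → T (f a b) → T (f a′ b′) → colour a b ≡ colour a′ b′ → a ≡ a′ × b ≡ b′) →
               ∑∑ (λ a b → ⟦ f a b ⟧) ≤ k
∑∑-≤-colours {m} {k} f colour injective = begin
  ∑∑ (λ a b → ⟦ f a b ⟧)                               ≡⟨ ∑∑-cong byColour ⟩
  ∑[ a < m ] ∑[ b < m ] ∑[ i < k ] ⟦ class i a b ⟧     ≡⟨ sum-cong-≗ (λ a → ∑-comm (λ b i → ⟦ class i a b ⟧)) ⟩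
  ∑[ a < m ] ∑[ i < k ] ∑[ b < m ] ⟦ class i a b ⟧     ≡⟨ ∑-comm (λ a i → ∑[ b < m ] ⟦ class i a b ⟧) ⟩
  ∑[ i < k ] ∑∑ (λ a b → ⟦ class i a b ⟧)              ≤⟨ ∑-mono-≤ classSize≤1 ⟩
  ∑[ i < k ] 1                                         ≡⟨ ∑-one k ⟩
  k                                                    ∎
  where
  open ≤-Reasoning

  class : Fin k → Fin m → Fin m → Bool
  class i a b = f a b ∧ does (colour a b ≟ᶠ i)

  byColour : ∀ a b → ⟦ f a b ⟧ ≡ ∑[ i < k ] ⟦ class i a b ⟧
  byColour a b with f a b
  ... | true = sym (∑-point (colour a b))
  ... | false = sym (sum-replicate-zero k)

  classSize≤1 : ∀ i → ∑∑ (λ a b → ⟦ class i a b ⟧) ≤ 1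
  classSize≤1 i = ∑∑-≤1 (class i) λ {a} {b} {a′} {b′} t t′ →
    let fab , c≡i = Equivalence.to (T-∧ {f a b}) t
        fab′ , c′≡i = Equivalence.to (T-∧ {f a′ b′}) t′
    in injective fab fab′ (trans (T-does (colour a b ≟ᶠ i) c≡i) (sym (T-does (colour a′ b′ ≟ᶠ i) c′≡i)))

∑∑-crossing : ∀ {m} (S : Fin m → Bool) →
  ∑∑ (λ a b → ⟦ does (a <ᶠ? b) ∧ (S a xor S b) ⟧) ≡ ∑[ a < m ] ⟦ S a ⟧ * ∑[ b < m ] ⟦ not (S b) ⟧
∑∑-crossing {m} S = begin
  ∑∑ (λ a b → ⟦ lt a b ∧ (S a xor S b) ⟧)
    ≡⟨ ∑∑-cong (λ a b → ⟦∧xor⟧ (lt a b) (S a) (S b)) ⟩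
  ∑∑ (λ a b → ⟦ lt a b ∧ inOut a b ⟧ + ⟦ lt a b ∧ inOut b a ⟧)
    ≡⟨ ∑∑-distrib-+ (λ a b → ⟦ lt a b ∧ inOut a b ⟧) (λ a b → ⟦ lt a b ∧ inOut b a ⟧) ⟩
  ∑∑ (λ a b → ⟦ lt a b ∧ inOut a b ⟧) + ∑∑ (λ a b → ⟦ lt a b ∧ inOut b a ⟧)
    ≡⟨ cong (∑∑ (λ a b → ⟦ lt a b ∧ inOut a b ⟧) +_) (∑-comm (λ a b → ⟦ lt a b ∧ inOut b a ⟧)) ⟩
  ∑∑ (λ a b → ⟦ lt a b ∧ inOut a b ⟧) + ∑∑ (λ a b → ⟦ lt b a ∧ inOut a b ⟧)
    ≡⟨ ∑∑-distrib-+ (λ a b → ⟦ lt a b ∧ inOut a b ⟧) (λ a b → ⟦ lt b a ∧ inOut a b ⟧) ⟨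
  ∑∑ (λ a b → ⟦ lt a b ∧ inOut a b ⟧ + ⟦ lt b a ∧ inOut a b ⟧)
    ≡⟨ ∑∑-cong oriented ⟩
  ∑∑ (λ a b → ⟦ inOut a b ⟧)
    ≡⟨ ∑∑-cong (λ a b → ⟦∧⟧ (S a) (not (S b))) ⟩
  ∑∑ (λ a b → ⟦ S a ⟧ * ⟦ not (S b) ⟧)
    ≡⟨ sum-cong-≗ (λ a → *-distribˡ-sum ⟦ S a ⟧ (⟦_⟧ ∘ not ∘ S)) ⟨
  ∑[ a < m ] (⟦ S a ⟧ * ∑[ b < m ] ⟦ not (S b) ⟧)
    ≡⟨ *-distribʳ-sum (∑[ b < m ] ⟦ not (S b) ⟧) (⟦_⟧ ∘ S) ⟨
  ∑[ a < m ] ⟦ S a ⟧ * ∑[ b < m ] ⟦ not (S b) ⟧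
    ∎
  where
  open ≡-Reasoning

  lt : Fin m → Fin m → Bool
  lt a b = does (a <ᶠ? b)

  inOut : Fin m → Fin m → Bool
  inOut a b = S a ∧ not (S b)

  oriented : ∀ a b → ⟦ lt a b ∧ inOut a b ⟧ + ⟦ lt b a ∧ inOut a b ⟧ ≡ ⟦ inOut a b ⟧
  oriented a b with <-cmp a b
  ... | tri< a<b _ b≮a rewrite dec-true (a <ᶠ? b) a<b | dec-false (b <ᶠ? a) b≮a = +-identityʳ _
  ... | tri> a≮b _ b<a rewrite dec-false (a <ᶠ? b) a≮b | dec-true (b <ᶠ? a) b<a = refl
  ... | tri≈ _ refl _ rewrite ∧-inverseʳ (S a) | ∧-zeroʳ (lt a a) = refl

<ᵇ-step : ∀ j h → (j <ᵇ h) ≢ (suc j <ᵇ h) → suc j ≡ h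
<ᵇ-step zero zero ne = contradiction refl ne
<ᵇ-step zero (suc zero) _ = refl
<ᵇ-step zero (suc (suc h)) ne = contradiction refl ne
<ᵇ-step (suc j) zero ne = contradiction refl ne
<ᵇ-step (suc j) (suc h) ne = cong suc (<ᵇ-step j h ne)

positiveUpTo : ℕ → ℕ → Bool
positiveUpTo h zero = false
positiveUpTo h (suc x) = x <ᵇ h

module Cycle (K : ℕ) where

  +1-mod : ∀ {j} → j < suc K →
           (j < K × (j + 1) % suc K ≡ suc j) ⊎ (j ≡ K × (j + 1) % suc K ≡ 0)
  +1-mod {j} j<m with j <? K
  ... | yes j<K = inj₁ (j<K , trans (cong (_% suc K) (+-comm j 1)) (m<n⇒m%n≡m (s≤s j<K)))
  ... | no j≮K = inj₂ (j≡K , trans (cong (_% suc K) (trans (+-comm j 1) (cong suc j≡K))) (n%n≡0 (suc K)))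
    where
    j≡K : j ≡ K
    j≡K = ≤-antisym (s≤s⁻¹ j<m) (≮⇒≥ j≮K)

  IsEdge : ℕ → Fin (suc K) → Fin (suc K) → Set
  IsEdge j x y = toℕ x ≡ j × toℕ y ≡ (j + 1) % suc K

  IsEdge-unique : ∀ {j x y x′ y′} → IsEdge j x y → IsEdge j x′ y′ → x ≡ x′ × y ≡ y′
  IsEdge-unique (x≡j , y≡) (x′≡j , y′≡) =
    toℕ-injective (trans x≡j (sym x′≡j)) , toℕ-injective (trans y≡ (sym y′≡))

  edgeOf : ∀ {a b} → CAdj (suc K) a b → ℕ
  edgeOf {a} (inj₁ _) = toℕ a
  edgeOf {b = b} (inj₂ _) = toℕ b

  edgeOf-IsEdge : ∀ {a b} (e : CAdj (suc K) a b) → IsEdge (edgeOf e) a b ⊎ IsEdge (edgeOf e) b a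
  edgeOf-IsEdge (inj₁ b≡) = inj₁ (refl , b≡)
  edgeOf-IsEdge (inj₂ a≡) = inj₂ (refl , a≡)

  usesEdge : ∀ {a c} → Walk (suc K) a c → ℕ → Bool
  usesEdge (nil _) j = false
  usesEdge (cons e w) j = (edgeOf e ≡ᵇ j) ∨ usesEdge w j

  Traverses : ∀ {a c} → Walk (suc K) a c → Fin (suc K) → Fin (suc K) → Set
  Traverses w x y = EdgeIn w x y ⊎ EdgeIn w y x

  usesEdge-sound : ∀ {a c} (w : Walk (suc K) a c) {j} → T (usesEdge w j) →
                   ∃₂ λ x y → IsEdge j x y × Traverses w x y
  usesEdge-sound (cons e w) {j} t with edgeOf e ≡ᵇ j | ≡ᵇ⇒≡ (edgeOf e) j
  ... | true | e≡j rewrite sym (e≡j _) =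
    [ (λ ab → _ , _ , ab , inj₁ (here e w)) , (λ ba → _ , _ , ba , inj₂ (here e w)) ]′ (edgeOf-IsEdge e)
  ... | false | _ with usesEdge-sound w t
  ...   | x , y , xy , p = x , y , xy , Sum.map (there e) (there e) p

  usesEdge-share : ∀ {a b c d} (P : Path (suc K) a b) (Q : Path (suc K) c d) {j} →
                   T (usesEdge (Path.walk P) j) → T (usesEdge (Path.walk Q) j) → ShareEdge P Q
  usesEdge-share P Q tP tQ with usesEdge-sound (Path.walk P) tP | usesEdge-sound (Path.walk Q) tQ
  ... | x , y , xy , inP | _ , _ , x′y′ , inQ with IsEdge-unique xy x′y′
  ...   | refl , refl = x , y , inP , inQ

  head∈verts : ∀ {a c} (w : Walk (suc K) a c) → a ∈ verts w
  head∈verts (nil _) = here refl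
  head∈verts (cons _ _) = here refl

  EdgeIn-verts : ∀ {a c x y} {w : Walk (suc K) a c} → EdgeIn w x y → x ∈ verts w × y ∈ verts w
  EdgeIn-verts (here e w) = here refl , there (head∈verts w)
  EdgeIn-verts (there e p) = Product.map there there (EdgeIn-verts p)

  Traverses-verts : ∀ {a c x y} {w : Walk (suc K) a c} → Traverses w x y → x ∈ verts w × y ∈ verts w
  Traverses-verts (inj₁ p) = EdgeIn-verts p
  Traverses-verts (inj₂ p) = Product.swap (EdgeIn-verts p)

  first-edge-not-reused : ∀ {a b c} (e : CAdj (suc K) a b) (w : Walk (suc K) b c) →
                          All (a ≢_) (verts w) → ¬ T (usesEdge w (edgeOf e))
  first-edge-not-reused e w a∉w t with usesEdge-sound w t
  ... | x , y , xy , p with edgeOf-IsEdge e | Traverses-verts p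
  ...   | inj₁ ab | x∈w , _ = All¬⇒¬Any a∉w (subst (_∈ verts w) (sym (proj₁ (IsEdge-unique ab xy))) x∈w)
  ...   | inj₂ ba | _ , y∈w = All¬⇒¬Any a∉w (subst (_∈ verts w) (sym (proj₂ (IsEdge-unique ba xy))) y∈w)

  usesEdge-cons : ∀ {a b c} (e : CAdj (suc K) a b) (w : Walk (suc K) b c) → Unique (verts (cons e w)) →
                  ∀ j → usesEdge (cons e w) j ≡ (edgeOf e ≡ᵇ j) xor usesEdge w j
  usesEdge-cons e w (a∉w ∷ _) j with edgeOf e ≡ᵇ j | ≡ᵇ⇒≡ (edgeOf e) j
  ... | false | _ = refl
  ... | true | e≡j rewrite sym (e≡j _) with usesEdge w (edgeOf e) in eq
  ...   | false = refl
  ...   | true = contradiction (Equivalence.from T-≡ eq) (first-edge-not-reused e w a∉w)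

  IsEdge-parity : ∀ {j x y} → IsEdge j x y →
                  (j ≡ᵇ K) xor (j ≡ᵇ 0) ≡ (toℕ x ≡ᵇ 0) xor (toℕ y ≡ᵇ 0)
  IsEdge-parity {x = x} (refl , y≡) with +1-mod (toℕ<n x)
  ... | inj₁ (x<K , x+1≡) rewrite y≡ | x+1≡ | ≡ᵇ-false (<⇒≢ x<K) = sym (xor-identityʳ _)
  ... | inj₂ (x≡K , x+1≡) rewrite y≡ | x+1≡ | ≡ᵇ-true x≡K = xor-comm true _

  edgeOf-parity : ∀ {a b} (e : CAdj (suc K) a b) →
                  (edgeOf e ≡ᵇ K) xor (edgeOf e ≡ᵇ 0) ≡ (toℕ a ≡ᵇ 0) xor (toℕ b ≡ᵇ 0)
  edgeOf-parity {a} {b} e with edgeOf-IsEdge e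
  ... | inj₁ ab = IsEdge-parity ab
  ... | inj₂ ba = trans (IsEdge-parity ba) (xor-comm (toℕ b ≡ᵇ 0) (toℕ a ≡ᵇ 0))

  -- Edges K and 0 are the two edges at vertex 0.
  usesEdge-parity : ∀ {a c} (w : Walk (suc K) a c) → Unique (verts w) →
                    usesEdge w K xor usesEdge w 0 ≡ (toℕ a ≡ᵇ 0) xor (toℕ c ≡ᵇ 0)
  usesEdge-parity (nil a) _ = sym (xor-same (toℕ a ≡ᵇ 0))
  usesEdge-parity {a} {c} (cons {b = b} e w) u@(_ ∷ uw) = begin
    usesEdge (cons e w) K xor usesEdge (cons e w) 0
      ≡⟨ cong₂ _xor_ (usesEdge-cons e w u K) (usesEdge-cons e w u 0) ⟩
    ((edgeOf e ≡ᵇ K) xor usesEdge w K) xor ((edgeOf e ≡ᵇ 0) xor usesEdge w 0)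
      ≡⟨ xor-interchange (edgeOf e ≡ᵇ K) (usesEdge w K) (edgeOf e ≡ᵇ 0) (usesEdge w 0) ⟩
    ((edgeOf e ≡ᵇ K) xor (edgeOf e ≡ᵇ 0)) xor (usesEdge w K xor usesEdge w 0)
      ≡⟨ cong₂ _xor_ (edgeOf-parity e) (usesEdge-parity w uw) ⟩
    ((toℕ a ≡ᵇ 0) xor (toℕ b ≡ᵇ 0)) xor ((toℕ b ≡ᵇ 0) xor (toℕ c ≡ᵇ 0))
      ≡⟨ xor-telescope (toℕ a ≡ᵇ 0) (toℕ b ≡ᵇ 0) (toℕ c ≡ᵇ 0) ⟩
    (toℕ a ≡ᵇ 0) xor (toℕ c ≡ᵇ 0)
      ∎
    where open ≡-Reasoning

  Boundary : (ℕ → Bool) → ℕ → ℕ → Set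
  Boundary S e₁ e₂ = ∀ {j} → j < suc K → S j ≢ S ((j + 1) % suc K) → j ≡ e₁ ⊎ j ≡ e₂

  IsEdge-cut : ∀ {S e₁ e₂} → Boundary S e₁ e₂ →
               ∀ {j x y} → IsEdge j x y → S (toℕ x) ≢ S (toℕ y) → j ≡ e₁ ⊎ j ≡ e₂
  IsEdge-cut {S} bd {x = x} (refl , y≡) Sx≢Sy = bd (toℕ<n x) (λ eq → Sx≢Sy (trans eq (cong S (sym y≡))))

  usesEdge-cut : ∀ {S e₁ e₂} → Boundary S e₁ e₂ → ∀ {a c} (w : Walk (suc K) a c) →
                 S (toℕ a) ≢ S (toℕ c) → T (usesEdge w e₁) ⊎ T (usesEdge w e₂)
  usesEdge-cut bd (nil _) Sa≢Sc = contradiction refl Sa≢Sc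
  usesEdge-cut {S} {e₁} {e₂} bd {a} (cons {b = b} e w) Sa≢Sc with S (toℕ a) ≟ᵇ S (toℕ b)
  ... | yes Sa≡Sb =
    Sum.map (T-∨-introʳ (edgeOf e ≡ᵇ e₁)) (T-∨-introʳ (edgeOf e ≡ᵇ e₂)) (usesEdge-cut bd w (Sa≢Sc ∘ trans Sa≡Sb))
  ... | no Sa≢Sb =
    Sum.map (T-∨-introˡ (usesEdge w e₁) ∘ ≡⇒≡ᵇ _ _) (T-∨-introˡ (usesEdge w e₂) ∘ ≡⇒≡ᵇ _ _) crossed
    where
    crossed : edgeOf e ≡ e₁ ⊎ edgeOf e ≡ e₂
    crossed = [ (λ ab → IsEdge-cut bd ab Sa≢Sb) , (λ ba → IsEdge-cut bd ba (Sa≢Sb ∘ sym)) ]′ (edgeOf-IsEdge e)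

  below-boundary : ∀ h → Boundary (_<ᵇ h) (pred h) K
  below-boundary h {j} j<m crosses with +1-mod j<m
  ... | inj₁ (_ , j+1≡) = inj₁ (cong pred (<ᵇ-step j h (λ eq → crosses (trans eq (cong (_<ᵇ h) (sym j+1≡))))))
  ... | inj₂ (j≡K , _) = inj₂ j≡K

  positiveUpTo-boundary : ∀ {h} → h < K → Boundary (positiveUpTo h) h 0
  positiveUpTo-boundary h<K {zero} _ _ = inj₂ refl
  positiveUpTo-boundary {h} h<K {suc j} j<m crosses with +1-mod j<m
  ... | inj₁ (_ , j+1≡) =
    inj₁ (<ᵇ-step j h (λ eq → crosses (trans eq (cong (positiveUpTo h) (sym j+1≡)))))
  ... | inj₂ (j≡K , j+1≡) =
    contradiction (trans (cong (positiveUpTo h) j+1≡) (sym (<ᵇ-false h≤j)) ) (crosses ∘ sym) 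
    where
    h≤j : h ≤ j
    h≤j = s≤s⁻¹ (subst (h <_) (sym j≡K) h<K)

module Packing {K : ℕ} (𝒫 : PathSystem (suc (suc K))) {k : ℕ}
               (ω : (a b : Fin (suc (suc K))) → a <ᶠ b → Fin k)
               (packing : IsGlobalPacking 𝒫 k ω) where

  open Cycle (suc K) public

  m : ℕ
  m = suc (suc K)

  routeUses : ℕ → Fin m → Fin m → Bool
  routeUses j a b with a <ᶠ? b
  ... | yes a<b = usesEdge (Path.walk (𝒫 a b a<b)) j
  ... | no _ = false

  Load : ℕ → ℕ
  Load j = ∑∑ {m} (λ a b → ⟦ routeUses j a b ⟧)

  Load-≤ : ∀ j → Load j ≤ k
  Load-≤ j = ∑∑-≤-colours (routeUses j) colour injective
    where
    colour : Fin m → Fin m → Fin k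
    colour a b with a <ᶠ? b
    ... | yes a<b = ω a b a<b
    ... | no _ = ω zero (suc zero) (s≤s z≤n)  -- junk: such pairs carry no route

    injective : ∀ {a b a′ b′} → T (routeUses j a b) → T (routeUses j a′ b′) →
                colour a b ≡ colour a′ b′ → a ≡ a′ × b ≡ b′
    injective {a} {b} {a′} {b′} t t′ same with a <ᶠ? b | a′ <ᶠ? b′
    ... | yes a<b | yes a′<b′ =
      decidable-stable ((a ≟ᶠ a′) ×-dec (b ≟ᶠ b′)) λ distinct →
        packing a b a′ b′ a<b a′<b′ distinct (usesEdge-share (𝒫 a b a<b) (𝒫 a′ b′ a′<b′) t t′) same
    ... | no _ | _ = ⊥-elim t
    ... | yes _ | no _ = ⊥-elim t′

  Load-cut : ∀ {S e₁ e₂} → Boundary S e₁ e₂ →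
             ∑[ a < m ] ⟦ S (toℕ a) ⟧ * ∑[ b < m ] ⟦ not (S (toℕ b)) ⟧ ≤ Load e₁ + Load e₂
  Load-cut {S} {e₁} {e₂} bd = begin
    ∑[ a < m ] ⟦ S (toℕ a) ⟧ * ∑[ b < m ] ⟦ not (S (toℕ b)) ⟧
      ≡⟨ ∑∑-crossing (λ (a : Fin m) → S (toℕ a)) ⟨
    ∑∑ {m} (λ a b → ⟦ does (a <ᶠ? b) ∧ (S (toℕ a) xor S (toℕ b)) ⟧)
      ≤⟨ ∑∑-mono-≤ {m} separated ⟩
    ∑∑ {m} (λ a b → ⟦ routeUses e₁ a b ⟧ + ⟦ routeUses e₂ a b ⟧)
      ≡⟨ ∑∑-distrib-+ (λ a b → ⟦ routeUses e₁ a b ⟧) (λ a b → ⟦ routeUses e₂ a b ⟧) ⟩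
    Load e₁ + Load e₂
      ∎
    where
    open ≤-Reasoning

    separated : ∀ a b → ⟦ does (a <ᶠ? b) ∧ (S (toℕ a) xor S (toℕ b)) ⟧ ≤
                        ⟦ routeUses e₁ a b ⟧ + ⟦ routeUses e₂ a b ⟧
    separated a b with a <ᶠ? b
    ... | no a≮b rewrite dec-false (a <ᶠ? b) a≮b = z≤n
    ... | yes a<b rewrite dec-true (a <ᶠ? b) a<b =
      ⟦xor⟧-≤ (S (toℕ a)) (S (toℕ b)) (⟦⟧+⟦⟧-pos ∘ usesEdge-cut bd (Path.walk (𝒫 a b a<b)))

  routedAroundZero : ℕ
  routedAroundZero = ∑∑ {m} (λ a b → ⟦ routeUses (suc K) a b ∧ routeUses 0 a b ⟧)

  Load-parity : Load (suc K) + Load 0 ≡ suc K + 2 * routedAroundZero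
  Load-parity = begin
    Load (suc K) + Load 0
      ≡⟨ ∑∑-distrib-+ (λ a b → ⟦ routeUses (suc K) a b ⟧) (λ a b → ⟦ routeUses 0 a b ⟧) ⟨
    ∑∑ {m} (λ a b → ⟦ routeUses (suc K) a b ⟧ + ⟦ routeUses 0 a b ⟧)
      ≡⟨ ∑∑-cong atZero ⟩
    ∑∑ {m} (λ a b → endsAtZero a b + 2 * ⟦ routeUses (suc K) a b ∧ routeUses 0 a b ⟧)
      ≡⟨ ∑∑-distrib-+ endsAtZero (λ a b → 2 * ⟦ routeUses (suc K) a b ∧ routeUses 0 a b ⟧) ⟩
    ∑∑ endsAtZero + ∑∑ {m} (λ a b → 2 * ⟦ routeUses (suc K) a b ∧ routeUses 0 a b ⟧)
      ≡⟨ cong₂ _+_ (∑∑-crossing {m} (λ a → toℕ a ≡ᵇ 0))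
                   (sym (*-distribˡ-∑∑ 2 (λ a b → ⟦ routeUses (suc K) a b ∧ routeUses 0 a b ⟧))) ⟩
    (1 + ∑[ a < suc K ] 0) * ∑[ b < suc K ] 1 + 2 * routedAroundZero
      ≡⟨ cong (λ z → (1 + z) * ∑[ b < suc K ] 1 + 2 * routedAroundZero) (sum-replicate-zero (suc K)) ⟩
    1 * ∑[ b < suc K ] 1 + 2 * routedAroundZero
      ≡⟨ cong (_+ 2 * routedAroundZero) (trans (*-identityˡ _) (∑-one (suc K))) ⟩
    suc K + 2 * routedAroundZero
      ∎
    where
    open ≡-Reasoning

    endsAtZero : Fin m → Fin m → ℕ
    endsAtZero a b = ⟦ does (a <ᶠ? b) ∧ ((toℕ a ≡ᵇ 0) xor (toℕ b ≡ᵇ 0)) ⟧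

    atZero : ∀ a b → ⟦ routeUses (suc K) a b ⟧ + ⟦ routeUses 0 a b ⟧ ≡
                     endsAtZero a b + 2 * ⟦ routeUses (suc K) a b ∧ routeUses 0 a b ⟧
    atZero a b with a <ᶠ? b
    ... | no a≮b rewrite dec-false (a <ᶠ? b) a≮b = refl
    ... | yes a<b rewrite dec-true (a <ᶠ? b) a<b =
      trans (⟦⟧+⟦⟧ (usesEdge w (suc K)) (usesEdge w 0))
            (cong (λ x → ⟦ x ⟧ + 2 * ⟦ usesEdge w (suc K) ∧ usesEdge w 0 ⟧)
                  (usesEdge-parity w (Path.simple (𝒫 a b a<b))))
      where
      w : Walk m a b
      w = Path.walk (𝒫 a b a<b)

saturated-cuts : ∀ {N k L₁ L₂ L₃ L₄ Y} → L₁ ≤ k → L₂ ≤ k → L₃ ≤ k → L₄ ≤ k →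
                 N ≤ L₁ + L₂ → N ≤ L₃ + L₄ → L₂ + L₄ ≡ suc (2 * Y) → N < 2 * k
saturated-cuts {N} {k} {L₂ = L₂} {L₄ = L₄} {Y} L₁≤k L₂≤k L₃≤k L₄≤k N≤L₁+L₂ N≤L₃+L₄ odd with N <? 2 * k
... | yes N<2k = N<2k
... | no N≮2k = contradiction (trans 2k≡L₂+L₄ odd) (even≢odd k Y)
  where
  2k≡k+k : 2 * k ≡ k + k
  2k≡k+k = cong (k +_) (+-identityʳ k)

  saturated : ∀ {L L′} → L ≤ k → L′ ≤ k → N ≤ L + L′ → L′ ≡ k
  saturated {L} {L′} L≤k L′≤k N≤L+L′ = ≤-antisym L′≤k (+-cancelˡ-≤ k k L′ (begin
    k + k  ≡⟨ 2k≡k+k ⟨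
    2 * k  ≤⟨ ≮⇒≥ N≮2k ⟩
    N      ≤⟨ N≤L+L′ ⟩
    L + L′ ≤⟨ +-monoˡ-≤ L′ L≤k ⟩
    k + L′ ∎))
    where open ≤-Reasoning

  2k≡L₂+L₄ : 2 * k ≡ L₂ + L₄
  2k≡L₂+L₄ = trans 2k≡k+k (cong₂ _+_ (sym (saturated L₁≤k L₂≤k N≤L₁+L₂)) (sym (saturated L₃≤k L₄≤k N≤L₃+L₄)))

n²<2k : ∀ n → 2 ≤ n → (𝒫 : PathSystem (2 * n)) {k : ℕ} (ω : (a b : Fin (2 * n)) → a <ᶠ b → Fin k) →
        IsGlobalPacking 𝒫 k ω → n * n < 2 * k
n²<2k (suc zero) (s≤s ())
n²<2k n@(suc (suc q)) _ 𝒫 ω packing =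
  saturated-cuts {Y = suc q + routedAroundZero} (Load-≤ (suc q)) (Load-≤ (suc K)) (Load-≤ n) (Load-≤ 0)
    (half-cut (below-boundary n) (∑-below (m≤m+n n (n + 0))))
    (half-cut (positiveUpTo-boundary (s≤s n≤K)) (∑-below (m≤n⇒m≤1+n n≤K)))
    (trans Load-parity (cong suc (odd-count q routedAroundZero)))
  where
  -- 2 * n unfolds to suc (suc K)
  K : ℕ
  K = q + (n + 0)

  open Packing {K} 𝒫 ω packing

  n≤K : n ≤ K
  n≤K = ≤-trans (m≤m+n n 0) (m≤n+m (n + 0) q)

  odd-count : ∀ p X → p + (suc (suc p) + 0) + 2 * X ≡ 2 * (suc p + X)
  odd-count = solve-∀

  half-cut : ∀ {S e₁ e₂} → Boundary S e₁ e₂ → ∑[ a < m ] ⟦ S (toℕ a) ⟧ ≡ n → n * n ≤ Load e₁ + Load e₂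
  half-cut {S} {e₁} {e₂} bd |S|≡n = subst (_≤ Load e₁ + Load e₂) (cong₂ _*_ |S|≡n |Sᶜ|≡n) (Load-cut bd)
    where
    |Sᶜ| : ℕ
    |Sᶜ| = ∑[ a < m ] ⟦ not (S (toℕ a)) ⟧

    |Sᶜ|≡n : |Sᶜ| ≡ n
    |Sᶜ|≡n = trans (+-cancelˡ-≡ n |Sᶜ| (n + 0) (trans (cong (_+ |Sᶜ|) (sym |S|≡n)) (∑-not (λ (a : Fin m) → S (toℕ a)))))
                   (+-identityʳ n)

2*nC2+n≡n*n : ∀ n → 2 * (n C 2) + n ≡ n * n
2*nC2+n≡n*n zero = refl
2*nC2+n≡n*n (suc n) = begin
  2 * (suc n C 2) + suc n      ≡⟨ cong (λ c → 2 * c + suc n) (nCk+nC[k+1]≡[n+1]C[k+1] n 1) ⟨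
  2 * (n C 1 + n C 2) + suc n  ≡⟨ cong (λ c → 2 * (c + n C 2) + suc n) (nC1≡n n) ⟩
  2 * (n + n C 2) + suc n      ≡⟨ regroup n (n C 2) ⟩
  suc (n + n + (2 * (n C 2) + n)) ≡⟨ cong (λ s → suc (n + n + s)) (2*nC2+n≡n*n n) ⟩
  suc (n + n + n * n)          ≡⟨ square-suc n ⟨
  suc n * suc n                ∎
  where
  open ≡-Reasoning
  regroup : ∀ n c → 2 * (n + c) + suc n ≡ suc (n + n + (2 * c + n))
  regroup = solve-∀
  square-suc : ∀ n → suc n * suc n ≡ suc (n + n + n * n)
  square-suc = solve-∀

n²<2k⇒bound : ∀ n k → n * n < 2 * k → n C 2 + n / 2 + 1 ≤ k
n²<2k⇒bound n k n²<2k = subst (_≤ k) (+-comm 1 (n C 2 + n / 2)) (*-cancelˡ-< 2 _ k (begin-strict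
  2 * (n C 2 + n / 2)          ≡⟨ *-distribˡ-+ 2 (n C 2) (n / 2) ⟩
  2 * (n C 2) + 2 * (n / 2)    ≤⟨ +-monoʳ-≤ (2 * (n C 2)) (subst (_≤ n) (*-comm (n / 2) 2) (m/n*n≤m n 2)) ⟩
  2 * (n C 2) + n              ≡⟨ 2*nC2+n≡n*n n ⟩
  n * n                        <⟨ n²<2k ⟩
  2 * k                        ∎))
  where open ≤-Reasoning

lemma1 : (n : ℕ) → 1 ≤ n →
    (𝒫 : PathSystem (2 * n)) (k : ℕ) (ω : (a b : Fin (2 * n)) → a <ᶠ b → Fin k) →
    IsGlobalPacking 𝒫 k ω →
    (n C 2) + n / 2 + 1 ≤ k
lemma1 (suc zero) _ 𝒫 k ω _ = ≤-trans (s≤s z≤n) (toℕ<n (ω zero (suc zero) (s≤s z≤n)))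
lemma1 n@(suc (suc _)) _ 𝒫 k ω packing = n²<2k⇒bound n k (n²<2k n (s≤s (s≤s z≤n)) 𝒫 ω packing)
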